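{- Let $n$ be a natural number and $i$ an index such that $A_i$ is infinite, has weak apartness, and $A_i\cap B^n\neq\emptyset$. Then $\lim_{y}\lim_{s} x(i,n,y,s)$ exists and equals the unique element of $A_i\cap B^n$.
   Context: For $x=\sum_{j=0}^{k}2^{n_j}\in\mathbb{Z}^+$ with $n_0<\dots<n_k$, $\mu(x)=n_k$, $\lambda(x)=n_0$; $B^n=\{x\in\mathbb{Z}^+:\mu(x)=n\}$. A set $A\subseteq\mathbb{Z}^+$ has weak apartness if for every $m$, $|B^m\cap A|\leq 1$, and for every $l$, at most two $x\in A$ have $\lambda(x)=l$. Let $W_e$ be the $e$-th recursively enumerable set and $W_{e,s}$ its stage-$s$ approximation. Let $\Phi_i(x,y)$ be the $i$-th $\Sigma^0_2$ formula and $g$ a total recursive function such that $\Phi_i(x,y)$ holds iff $W_{g(i,x,y)}$ is finite. Set $F(i,x,y,s)=\max_{y'\leq y}|W_{g(i,x,y'),s}|$ and $A_i=\{x:\forall y\ \Phi_i(x,y)\}=\{x:\forall y\ \lim_s F(i,x,y,s)<\infty\}$ (so the $A_i$ range over all $\Pi^0_3$ sets). Define $x(i,n,y,s)=\min\{x\in B^n:\forall x'\in B^n\ F(i,x,y,s)\leq F(i,x',y,s)\}$. -}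

module Defs where

open import Data.Nat using (ℕ; zero; suc; _+_; _^_; _≤_; _<_; _⊔_)
open import Data.Nat.Divisibility using (_∣_)
open import Data.Bool using (Bool; true; false; if_then_else_)
open import Data.Product using (_×_; Σ; ∃; ∃-syntax)
open import Data.Sum using (_⊎_)
open import Relation.Nullary using (¬_)
open import Relation.Binary.PropositionalEquality using (_≡_)

-- Binary expansion x = Σ_j 2^{n_j}, n_0 < … < n_k, for x ≥ 1.
-- μ(x) = n_k (leading bit position):   μ(x) = n  iff  2^n ≤ x < 2^(n+1).
Mu : ℕ → ℕ → Set
Mu x n = 2 ^ n ≤ x × x < 2 ^ suc n

-- λ(x) = n_0 (lowest bit position):    λ(x) = l  iff  2^l ∣ x and ¬ 2^(l+1) ∣ x  (x ≥ 1).
Lam : ℕ → ℕ → Set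
Lam x l = 1 ≤ x × (2 ^ l ∣ x) × ¬ (2 ^ suc l ∣ x)

B : ℕ → ℕ → Set
B n x = Mu x n

Pred : Set₁
Pred = ℕ → Set

WeakApart : Pred → Set
WeakApart A =
  (∀ m x x' → A x → A x' → Mu x m → Mu x' m → x ≡ x')
  × (∀ l x y z → A x → A y → A z → Lam x l → Lam y l → Lam z l →
       (x ≡ y) ⊎ (x ≡ z) ⊎ (y ≡ z))

Infinite : Pred → Set
Infinite A = ∀ m → ∃[ x ] (m ≤ x × A x)

-- An enumeration of r.e. sets with stage approximations:
-- WA e s x = true  iff  x ∈ W_{e,s}.  Standard conventions:
-- W_{e,s} ⊆ {0,…,s-1} (so it is finite) and W_{e,s} ⊆ W_{e,s+1}.
Approx : Set
Approx = ℕ → ℕ → ℕ → Bool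

IsStageApprox : Approx → Set
IsStageApprox WA =
  (∀ e s x → WA e s x ≡ true → x < s)
  × (∀ e s x → WA e s x ≡ true → WA e (suc s) x ≡ true)

count : (ℕ → Bool) → ℕ → ℕ
count p zero = zero
count p (suc k) = count p k + (if p k then 1 else 0)

card : Approx → ℕ → ℕ → ℕ
card WA e s = count (WA e s) s

F : Approx → (ℕ → ℕ → ℕ → ℕ) → ℕ → ℕ → ℕ → ℕ → ℕ
F WA g i x zero s = card WA (g i x zero) s
F WA g i x (suc y) s = F WA g i x y s ⊔ card WA (g i x (suc y)) s

-- A_i = { x ∈ ℤ⁺ : ∀ y, lim_s F(i,x,y,s) < ∞ }
-- (F is nondecreasing in s, so the limit is finite iff F(i,x,y,·) is bounded)
A : Approx → (ℕ → ℕ → ℕ → ℕ) → ℕ → Pred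
A WA g i x = 1 ≤ x × (∀ y → ∃[ b ] (∀ s → F WA g i x y s ≤ b))

-- "x(i,n,y,s) = v" : v is the least x ∈ B^n minimising F(i,·,y,s) over B^n
IsMinimal : Approx → (ℕ → ℕ → ℕ → ℕ) → ℕ → ℕ → ℕ → ℕ → ℕ → Set
IsMinimal WA g i n y s x = B n x × (∀ x' → B n x' → F WA g i x y s ≤ F WA g i x' y s)

XVal : Approx → (ℕ → ℕ → ℕ → ℕ) → ℕ → ℕ → ℕ → ℕ → ℕ → Set
XVal WA g i n y s v =
  IsMinimal WA g i n y s v × (∀ x → IsMinimal WA g i n y s x → v ≤ x)

module Submission where

-- Weak apartness leaves a as the only element of A_i ∩ B^n. For fixed y every
-- F(i,x,y,·) is nondecreasing and F(i,a,y,·) is bounded, so the minimal value over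
-- the finite set B^n is eventually constant, after which the least minimiser only
-- moves up inside B^n and hence settles. Every other x ∈ B^n lies outside A_i, so
-- F(i,x,y,·) is unbounded for some y, hence for all larger y; past the largest of
-- these finitely many thresholds only a has bounded values and is the limit.

open import Defs
open import Data.Nat using (ℕ; zero; suc; _+_; _<_; _≤_; _≤′_; ≤′-refl; ≤′-step; _⊔_; _^_; z≤n; _≟_)
open import Data.Nat.Properties
open import Data.Nat.Induction using (<-rec)
open import Data.Bool using (true; false)
open import Data.Product using (_×_; _,_; proj₁; proj₂; ∃; ∃-syntax)
open import Data.Sum using (inj₁; inj₂)
open import Data.Empty using (⊥-elim)
open import Function using (case_of_)
open import Relation.Nullary using (¬_; yes; no)
open import Relation.Nullary.Decidable using (decidable-stable)
open import Relation.Binary.Definitions using (Monotonic₁)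
open import Relation.Binary.PropositionalEquality using (_≡_; refl; sym; trans; subst)
open import Axiom.ExcludedMiddle using (ExcludedMiddle)
open import Level using (0ℓ)

Bounded : (ℕ → ℕ) → Set
Bounded f = ∃[ c ] (∀ s → f s ≤ c)

≤-suc⇒monotone : (f : ℕ → ℕ) → (∀ s → f s ≤ f (suc s)) → Monotonic₁ _≤_ _≤_ f
≤-suc⇒monotone f step s≤s' = go (≤⇒≤′ s≤s')
  where
  go : ∀ {s s'} → s ≤′ s' → f s ≤ f s'
  go ≤′-refl        = ≤-refl
  go (≤′-step s≤s') = ≤-trans (go s≤s') (step _)

count-mono : ∀ p q → (∀ x → p x ≡ true → q x ≡ true) → ∀ k → count p k ≤ count q k
count-mono p q p⊆q zero = z≤n
count-mono p q p⊆q (suc k) with p k in pk | q k in qk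
... | true  | true  = +-monoˡ-≤ 1 (count-mono p q p⊆q k)
... | true  | false = case trans (sym (p⊆q k pk)) qk of λ ()
... | false | true  = +-mono-≤ (count-mono p q p⊆q k) z≤n
... | false | false = +-monoˡ-≤ 0 (count-mono p q p⊆q k)

card-≤-suc : ∀ {WA} → IsStageApprox WA → ∀ e s → card WA e s ≤ card WA e (suc s)
card-≤-suc {WA} stage e s =
  ≤-trans (count-mono (WA e s) (WA e (suc s)) (proj₂ stage e s) s) (m≤m+n _ _)

F-mono-stage : ∀ {WA} → IsStageApprox WA → ∀ g i x y → Monotonic₁ _≤_ _≤_ (F WA g i x y)
F-mono-stage {WA} stage g i x y = ≤-suc⇒monotone (F WA g i x y) (step y)
  where
  step : ∀ y s → F WA g i x y s ≤ F WA g i x y (suc s)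
  step zero    s = card-≤-suc stage _ s
  step (suc y) s = ⊔-mono-≤ (step y s) (card-≤-suc stage _ s)

F-mono-index : ∀ WA g i x s → Monotonic₁ _≤_ _≤_ (λ y → F WA g i x y s)
F-mono-index WA g i x s = ≤-suc⇒monotone (λ y → F WA g i x y s) (λ y → m≤m⊔n _ _)

Least : (ℕ → Set) → ℕ → Set
Least P x = P x × (∀ y → P y → x ≤ y)

module Classical (em : ExcludedMiddle 0ℓ) where

  least-exists : (P : ℕ → Set) → ∃ P → ∃ (Least P)
  least-exists P (w , Pw) = <-rec (λ w → P w → ∃ (Least P)) step w Pw
    where
    step : ∀ w → (∀ {v} → v < w → P v → ∃ (Least P)) → P w → ∃ (Least P)
    step w below Pw with em {∃[ v ] (v < w × P v)}
    ... | yes (v , v<w , Pv) = below v<w Pv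
    ... | no ∄v = w , Pw , λ v Pv → ≮⇒≥ (λ v<w → ∄v (v , v<w , Pv))

  ¬∀⇒∃¬ : (Q : ℕ → Set) → ¬ (∀ y → Q y) → ∃[ y ] ¬ Q y
  ¬∀⇒∃¬ Q ¬∀Q = decidable-stable em λ ∄y →
    ¬∀Q (λ y → decidable-stable em (λ ¬Qy → ∄y (y , ¬Qy)))

  -- The fuel k bounds how often f can still strictly increase before exceeding b.
  bounded-monotone-stabilises : (f : ℕ → ℕ) (t₀ b : ℕ) →
    (∀ {s s'} → t₀ ≤ s → s ≤ s' → f s ≤ f s') → (∀ s → f s ≤ b) →
    ∃[ s₀ ] (t₀ ≤ s₀ × (∀ s → s₀ ≤ s → f s ≡ f s₀))
  bounded-monotone-stabilises f t₀ b mono f≤b = go b t₀ ≤-refl (m≤n+m b (f t₀))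
    where
    go : ∀ k t → t₀ ≤ t → b ≤ f t + k → ∃[ s₀ ] (t₀ ≤ s₀ × (∀ s → s₀ ≤ s → f s ≡ f s₀))
    go k t t₀≤t b≤ft+k with em {∃[ s ] (t ≤ s × f t < f s)}
    go zero    t t₀≤t b≤ft+0 | yes (s , t≤s , ft<fs) =
      ⊥-elim (<⇒≱ ft<fs (≤-trans (f≤b s) (subst (b ≤_) (+-identityʳ (f t)) b≤ft+0)))
    go (suc k) t t₀≤t b≤ft+k | yes (s , t≤s , ft<fs) =
      go k s (≤-trans t₀≤t t≤s)
        (≤-trans b≤ft+k (subst (_≤ f s + k) (sym (+-suc (f t) k)) (+-monoˡ-≤ k ft<fs)))
    go k t t₀≤t b≤ft+k | no ∄s =
      t , t₀≤t , λ s t≤s → ≤-antisym (≮⇒≥ (λ ft<fs → ∄s (s , t≤s , ft<fs))) (mono t₀≤t t≤s)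

  uniform-threshold : (P : ℕ → Set) (Q : ℕ → ℕ → Set) →
    (∀ x {y y'} → y ≤ y' → Q x y → Q x y') → (∀ x → P x → ∃ (Q x)) →
    ∀ k → ∃[ Y ] (∀ x → x < k → P x → ∀ y → Y ≤ y → Q x y)
  uniform-threshold P Q Q-up Q-exists zero = 0 , λ x ()
  uniform-threshold P Q Q-up Q-exists (suc k)
    with uniform-threshold P Q Q-up Q-exists k | em {P k}
  ... | Y , below | no ¬Pk = Y , above
    where
    above : ∀ x → x < suc k → P x → ∀ y → Y ≤ y → Q x y
    above x x<1+k Px with m<1+n⇒m<n∨m≡n x<1+k
    ... | inj₁ x<k  = below x x<k Px
    ... | inj₂ refl = ⊥-elim (¬Pk Px)
  ... | Y , below | yes Pk = Y ⊔ yₖ , above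
    where
    yₖ : ℕ
    yₖ = proj₁ (Q-exists k Pk)
    above : ∀ x → x < suc k → P x → ∀ y → Y ⊔ yₖ ≤ y → Q x y
    above x x<1+k Px y Y⊔yₖ≤y with m<1+n⇒m<n∨m≡n x<1+k
    ... | inj₁ x<k  = below x x<k Px y (≤-trans (m≤m⊔n Y yₖ) Y⊔yₖ≤y)
    ... | inj₂ refl = Q-up x (≤-trans (m≤n⊔m Y yₖ) Y⊔yₖ≤y) (proj₂ (Q-exists k Pk))

  module LeastMinimiser (D : ℕ → Set) (hi : ℕ) (D⇒<hi : ∀ x → D x → x < hi)
    (h : ℕ → ℕ → ℕ) (h-mono : ∀ x → Monotonic₁ _≤_ _≤_ (h x))
    (a : ℕ) (Da : D a) (a-bounded : Bounded (h a)) where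

    IsMin : ℕ → ℕ → Set
    IsMin s x = D x × (∀ x' → D x' → h x s ≤ h x' s)

    LeastMin : ℕ → ℕ → Set
    LeastMin s = Least (IsMin s)

    leastMin-exists : ∀ s → ∃ (LeastMin s)
    leastMin-exists s with least-exists (λ v → ∃[ x ] (D x × h x s ≡ v)) (h a s , a , Da , refl)
    ... | _ , (x , Dx , refl) , value-least =
      least-exists (IsMin s) (x , Dx , λ x' Dx' → value-least (h x' s) (x' , Dx' , refl))

    x* : ℕ → ℕ
    x* s = proj₁ (leastMin-exists s)

    x*-min : ∀ s → IsMin s (x* s)
    x*-min s = proj₁ (proj₂ (leastMin-exists s))

    x*-least : ∀ s x → IsMin s x → x* s ≤ x
    x*-least s = proj₂ (proj₂ (leastMin-exists s))

    min-value : ℕ → ℕ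
    min-value s = h (x* s) s

    min-value-mono : ∀ {s s'} → s ≤ s' → min-value s ≤ min-value s'
    min-value-mono {s} {s'} s≤s' =
      ≤-trans (proj₂ (x*-min s) (x* s') (proj₁ (x*-min s'))) (h-mono (x* s') s≤s')

    min-value-bounded : ∀ s → min-value s ≤ proj₁ a-bounded
    min-value-bounded s = ≤-trans (proj₂ (x*-min s) a Da) (proj₂ a-bounded s)

    -- Once the minimal value is constant, x* s' is still a minimiser at the earlier
    -- stage s, so the least minimiser can only move upwards.
    leastMin-converges : ∃[ L ] ∃[ s₀ ] (∀ s → s₀ ≤ s → LeastMin s L)
    leastMin-converges =
      x* s₂ , s₂ , λ s s₂≤s → subst (LeastMin s) (x*-stable s s₂≤s) (proj₂ (leastMin-exists s))
      where
      value-stable : ∃[ s₁ ] (0 ≤ s₁ × (∀ s → s₁ ≤ s → min-value s ≡ min-value s₁))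
      value-stable = bounded-monotone-stabilises min-value 0 (proj₁ a-bounded)
                       (λ _ → min-value-mono) min-value-bounded
      s₁ : ℕ
      s₁ = proj₁ value-stable
      min-value-const : ∀ s → s₁ ≤ s → min-value s ≡ min-value s₁
      min-value-const = proj₂ (proj₂ value-stable)
      x*-mono : ∀ {s s'} → s₁ ≤ s → s ≤ s' → x* s ≤ x* s'
      x*-mono {s} {s'} s₁≤s s≤s' = x*-least s (x* s') (proj₁ (x*-min s') , λ x' Dx' →
        begin
          h (x* s') s   ≤⟨ h-mono (x* s') s≤s' ⟩
          min-value s'  ≡⟨ min-value-const s' (≤-trans s₁≤s s≤s') ⟩
          min-value s₁  ≡⟨ min-value-const s s₁≤s ⟨
          min-value s   ≤⟨ proj₂ (x*-min s) x' Dx' ⟩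
          h x' s        ∎)
        where open ≤-Reasoning
      argmin-stable : ∃[ s₂ ] (s₁ ≤ s₂ × (∀ s → s₂ ≤ s → x* s ≡ x* s₂))
      argmin-stable = bounded-monotone-stabilises x* s₁ hi x*-mono
                        (λ s → <⇒≤ (D⇒<hi _ (proj₁ (x*-min s))))
      s₂ : ℕ
      s₂ = proj₁ argmin-stable
      x*-stable : ∀ s → s₂ ≤ s → x* s ≡ x* s₂
      x*-stable = proj₂ (proj₂ argmin-stable)

    limit-bounded : ∀ {L s₀} → (∀ s → s₀ ≤ s → LeastMin s L) → Bounded (h L)
    limit-bounded {L} {s₀} converges = proj₁ a-bounded , λ s →
      ≤-trans (h-mono L (m≤m⊔n s s₀))
        (≤-trans (proj₂ (proj₁ (converges (s ⊔ s₀) (m≤n⊔m s s₀))) a Da)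
                 (proj₂ a-bounded (s ⊔ s₀)))

  eventually-only-bounded : ∀ WA g i n a → (∀ x → A WA g i x → B n x → x ≡ a) →
    ∃[ y₀ ] (∀ y → y₀ ≤ y → ∀ x → B n x → Bounded (F WA g i x y) → x ≡ a)
  eventually-only-bounded WA g i n a unique = y₀ , only-a-bounded
    where
    threshold : ∃[ y₀ ] (∀ x → x < 2 ^ suc n → B n x × ¬ x ≡ a →
                           ∀ y → y₀ ≤ y → ¬ Bounded (F WA g i x y))
    threshold = uniform-threshold (λ x → B n x × ¬ x ≡ a) (λ x y → ¬ Bounded (F WA g i x y))
      (λ x y≤y' unbounded (c , F≤c) →
         unbounded (c , λ s → ≤-trans (F-mono-index WA g i x s y≤y') (F≤c s)))
      (λ x (Bx , x≢a) → ¬∀⇒∃¬ _ λ bounded →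
         x≢a (unique x (≤-trans (m^n>0 2 n) (proj₁ Bx) , bounded) Bx))
      (2 ^ suc n)
    y₀ : ℕ
    y₀ = proj₁ threshold
    only-a-bounded : ∀ y → y₀ ≤ y → ∀ x → B n x → Bounded (F WA g i x y) → x ≡ a
    only-a-bounded y y₀≤y x Bx bounded with x ≟ a
    ... | yes x≡a = x≡a
    ... | no x≢a = ⊥-elim (proj₂ threshold x (proj₂ Bx) (Bx , x≢a) y y₀≤y bounded)

mainTheorem12 : ExcludedMiddle 0ℓ →
    (WA : Approx) → IsStageApprox WA → (g : ℕ → ℕ → ℕ → ℕ) →
    (n i : ℕ) →
    Infinite (A WA g i) → WeakApart (A WA g i) →
    ∃[ x ] (A WA g i x × B n x) →
    ∃[ a ] ((A WA g i a × B n a)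
      × (∀ b → A WA g i b → B n b → b ≡ a)
      × (∀ y → ∃[ L ] ∃[ s₀ ] (∀ s → s₀ ≤ s → XVal WA g i n y s L))
      × ∃[ y₀ ] (∀ y → y₀ ≤ y → ∃[ s₀ ] (∀ s → s₀ ≤ s → XVal WA g i n y s a)))
mainTheorem12 em WA stage g n i _ apart (a , Aa , Ba) =
  a , (Aa , Ba) , unique , limit-exists , limit-is-a
  where
  open Classical em

  unique : ∀ b → A WA g i b → B n b → b ≡ a
  unique b Ab Bb = proj₁ apart n b a Ab Aa Bb Ba

  module Min (y : ℕ) = LeastMinimiser (B n) (2 ^ suc n) (λ _ → proj₂) (λ x → F WA g i x y)
                         (λ x → F-mono-stage stage g i x y) a Ba (proj₂ Aa y)

  limit-exists : ∀ y → ∃[ L ] ∃[ s₀ ] (∀ s → s₀ ≤ s → XVal WA g i n y s L)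
  limit-exists = Min.leastMin-converges

  limit-is-a : ∃[ y₀ ] (∀ y → y₀ ≤ y → ∃[ s₀ ] (∀ s → s₀ ≤ s → XVal WA g i n y s a))
  limit-is-a with eventually-only-bounded WA g i n a unique
  ... | y₀ , only-a-bounded = y₀ , λ y y₀≤y →
    let (L , s₀ , converges) = limit-exists y
        L≡a = only-a-bounded y y₀≤y L (proj₁ (proj₁ (converges s₀ ≤-refl)))
                (Min.limit-bounded y converges)
    in s₀ , λ s s₀≤s → subst (XVal WA g i n y s) L≡a (converges s s₀≤s)
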